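{- For every integer $u\ge 5$, $$9\,T_{24}^{(3\cdot 2^u)}\equiv \mathbf{T}_0+2^{u-3}\mathbf{T}_1\pmod{2^u}$$ (entrywise), where $\mathbf{T}_0=\mathrm{Toepl}\big((0,0,0,0,0,0,0,0,1,0,0,0,0,0,0,0,2,0,0,0,0,0,0,0),\,(0,0,0,0,0,0,0,-1,0,0,0,0,0,0,0,-2,0,0,0,0,0,0,0)\big)$ and $\mathbf{T}_1=\mathrm{Toepl}\big((3,0,0,0,4,0,0,0,3,0,4,0,6,0,4,0,4,0,4,0,6,0,4,0),\,(0,0,0,4,0,0,0,2,0,4,0,2,0,4,0,1,0,4,0,2,0,4,0)\big)$.
   Context: For positive integers $k$ and non-negative integers $i$, $T_k^{(i)}$ is the $k\times k$ integer matrix with $(T_k^{(i)})_{r,s}=\sum_{\alpha\in\mathbb{Z}}\alpha\binom{i}{\alpha k+r-s}$ for $r,s\in\{1,\dots,k\}$, with $\binom{a}{b}=0$ if $b<0$ or $b>a$. For a $k$-tuple $S_1=(u_0,u_1,\dots,u_{k-1})$ and a $(k-1)$-tuple $S_2=(u_{ -1},u_{ -2},\dots,u_{ -(k-1)})$, $\mathrm{Toepl}(S_1,S_2)$ is the $k\times k$ Toeplitz matrix whose $(r,s)$ entry is $u_{r-s}$, $r,s\in\{1,\dots,k\}$. -}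

module Defs where

open import Data.Nat as ℕ using (ℕ; zero; suc; _∸_; _≤ᵇ_; _<_)
open import Data.Nat.Properties using (m∸n≤m; ≤-<-trans)
open import Data.Nat.Combinatorics using (_C_)
open import Data.Integer as ℤ using (ℤ; +_; -[1+_]; _+_; _-_; _*_)
open import Data.Fin using (Fin; toℕ; fromℕ<)
open import Data.Fin.Properties using (toℕ<n)
open import Data.Bool using (true; false)
open import Data.List using (List; map; upTo; foldr)
open import Data.Vec using (Vec; lookup)

-- Binomial coefficient with integer lower index: binom a b = 0 if b < 0
-- (and stdlib's  a C b  is 0 for b > a).
binomℤ : ℕ → ℤ → ℤ
binomℤ a (+ b)     = + (a C b)
binomℤ a -[1+ b ]  = + 0

sumℤ : List ℤ → ℤ
sumℤ = foldr _+_ (+ 0)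

-- The integers -(i+1), ..., i+1.  For |α| ≥ i+2 and 1 ≤ r,s ≤ k we have
-- |αk + r - s| ≥ (i+2)k - (k-1) > i, so binom i (αk+r-s) = 0: the sum over
-- α ∈ ℤ in the definition of T_k^{(i)} is exactly the sum over this range.
alphaRange : ℕ → List ℤ
alphaRange i = map (λ j → + j - + (suc i)) (upTo (suc (suc (2 ℕ.* i ℕ.+ 1))))

-- (T_k^{(i)})_{r,s} = Σ_{α ∈ ℤ} α * binom(i, αk + r - s),
-- with rows/columns r,s ∈ {1..k} represented by Fin k (r = toℕ r' + 1).
T : (k i : ℕ) → Fin k → Fin k → ℤ
T k i r s = sumℤ (map (λ α → α * binomℤ i (α * + k + + suc (toℕ r) - + suc (toℕ s))) (alphaRange i))

-- Toeplitz matrix Toepl(S1,S2) of size (suc n), entry (r,s) = u_{r-s},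
-- where S1 = (u_0,...,u_n) and S2 = (u_{-1},...,u_{-n}).
Toepl : {n : ℕ} → Vec ℤ (suc n) → Vec ℤ n → Fin (suc n) → Fin (suc n) → ℤ
Toepl {n} S1 S2 r s with toℕ s ≤ᵇ toℕ r
... | true  = lookup S1 (fromℕ< (≤-<-trans (m∸n≤m (toℕ r) (toℕ s)) (toℕ<n r)))
... | false = helper (toℕ s) (toℕ<n s)
  where
  -- index s - r - 1 into S2 (only used when s > r, so s ≥ 1)
  helper : (m : ℕ) → m < suc n → ℤ
  helper zero    _  = + 0   -- unreachable (s > r ≥ 0)
  helper (suc m) lt = lookup S2 (fromℕ< (≤-<-trans (m∸n≤m m (toℕ r)) (ℕ.s≤s⁻¹ lt)))

{-# OPTIONS --safe #-}
module Submission where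

-- Write Aₙ for (1 + x)ⁿ in ℤ[x]/(x²⁴ − 1), so that Aₙ(e) = Σ_α binom(n, 24α + e).  Writing
-- 24α = (24α + d) − d and absorbing 24α + d by j·binom(n+1, j) = (n+1)·binom(n, j−1) turns
-- the defining sum of T into
--   24·T₂₄^(n+1)_{r,s} = (n+1)·Aₙ(e − 1) − d·Aₙ₊₁(e),   d = r − s,  e ≡ d (mod 24).
-- For t = 2^j ≥ 4 there are explicit P, Q, R with 3·A_{24t} ≡ P + tQ (mod 64t) and
-- A_{24t−1} ≡ R (mod 8).  For t = 4, 8, 16 this is computed (Q depends on t below 16), and it
-- passes from t to 2t because A_{48t} = A_{24t}² and A_{48t−1} = A_{24t}·A_{24t−1}: writing
-- 3A_{24t} = P + tQ + 64tE and using P² = 3P, PQ ≡ 3Q (mod 64), Q² ≡ 0 (mod 8) and 16 ∣ t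
-- gives 9A_{48t} ≡ 3P + 6tQ (mod 128t), PR ≡ 3R (mod 8) gives 3A_{48t−1} ≡ 3R (mod 8), and
-- 3 is invertible modulo powers of 2.  Substituting both congruences into the formula for T
-- leaves, for each of the 576 entries, a congruence modulo 192 that is checked by computation.

open import Defs
open import Data.Nat using (ℕ; _≤_; _^_; _∸_) renaming (_*_ to _*ℕ_)
open import Data.Integer using (ℤ; +_; -_; _+_; _-_; _*_)
open import Data.Integer.Divisibility using (_∣_)
open import Data.Fin using (Fin)
open import Data.Vec using (Vec; []; _∷_)

open import Data.Nat as ℕ using (zero; suc; s≤s; z≤n)
import Data.Nat.Properties as ℕₚ
open import Data.Nat.DivMod using (_%_; _mod_; %-distribˡ-+; m%n%n≡m%n; m<n⇒m%n≡m; [m+n]%n≡m%n)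
open import Data.Nat.Combinatorics using (_C_; nCk+nC[k+1]≡[n+1]C[k+1]; nC1≡n; k>n⇒nCk≡0)
open import Data.Nat.Divisibility using (∣1⇒≡1; ∣-trans)
import Data.Nat.Coprimality as ℕC
import Data.Nat.Tactic.RingSolver as ℕ-Solver
open import Data.Integer as ℤ using (-[1+_])
import Data.Integer.Properties as ℤₚ
import Data.Integer.Coprimality as ℤC
import Data.Integer.Divisibility.Signed as Signed
open Signed using (_∣?_; divides; quotient; ∣ᵤ⇒∣; ∣⇒∣ᵤ) renaming (_∣_ to _∣ˢ_)
open import Data.Integer.Tactic.RingSolver using (solve-∀)
open import Data.Fin using (zero; suc; toℕ; fromℕ; inject₁)
import Data.Fin.Properties as Finₚ
open Finₚ using (all?)
open import Data.Vec using (tabulate; lookup)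
open import Data.Vec.Properties using (lookup∘tabulate)
open import Data.Vec.Functional using (Vector) renaming ([] to []ᶠ; _∷_ to _∷ᶠ_)
open import Data.List using (map; applyUpTo)
open import Data.List.Properties using (map-∘)
open import Data.Bool using (Bool; true; false)
open import Data.Empty using (⊥-elim)
open import Data.Product using (_×_; _,_; proj₁; proj₂; Σ-syntax)
open import Function using (_∘_)
open import Relation.Nullary using (Dec; does; yes; no)
open import Relation.Nullary.Decidable using (from-yes; _×-dec_)
open import Relation.Binary.PropositionalEquality hiding ([_])
open import Algebra.Properties.Semiring.Sum ℤₚ.+-*-semiring
  using (sum; sum-syntax; sum-cong-≗; ∑-distrib-+; ∑-comm; sum-init-last; sum-replicate-zero; *-distribˡ-sum)
open import Algebra.Properties.CommutativeSemigroup ℕₚ.+-commutativeSemigroup using (xy∙z≈xz∙y)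
open import Algebra.Properties.AbelianGroup ℤₚ.+-0-abelianGroup using (∙-cancelˡ)
open ≡-Reasoning

indicator : Bool → ℤ
indicator true  = + 1
indicator false = + 0

∑-indicator : ∀ {m} (g : Vector ℤ m) d → ∑[ b < m ] (indicator (does (b Finₚ.≟ d)) * g b) ≡ g d
∑-indicator {suc m} g zero = begin
  + 1 * g zero + ∑[ b < m ] (+ 0 * g (suc b))
    ≡⟨ cong₂ _+_ (ℤₚ.*-identityˡ (g zero)) (sum-cong-≗ (ℤₚ.*-zeroˡ ∘ g ∘ suc)) ⟩
  g zero + ∑[ b < m ] (+ 0) ≡⟨ cong (_+_ (g zero)) (sum-replicate-zero m) ⟩
  g zero + + 0              ≡⟨ ℤₚ.+-identityʳ (g zero) ⟩
  g zero                    ∎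
∑-indicator {suc m} g (suc d) = begin
  + 0 * g zero + ∑[ b < m ] (indicator (does (b Finₚ.≟ d)) * g (suc b))
    ≡⟨ cong₂ _+_ (ℤₚ.*-zeroˡ (g zero)) (∑-indicator (g ∘ suc) d) ⟩
  + 0 + g (suc d) ≡⟨ ℤₚ.+-identityˡ (g (suc d)) ⟩
  g (suc d)       ∎

x*[0*y]≡0 : ∀ x y → x * (+ 0 * y) ≡ + 0
x*[0*y]≡0 = solve-∀

[m%n+k]%n≡[m+k]%n : ∀ m k n .{{_ : ℕ.NonZero n}} → (m % n ℕ.+ k) % n ≡ (m ℕ.+ k) % n
[m%n+k]%n≡[m+k]%n m k n = begin
  (m % n ℕ.+ k) % n         ≡⟨ %-distribˡ-+ (m % n) k n ⟩
  (m % n % n ℕ.+ k % n) % n ≡⟨ cong (λ x → (x ℕ.+ k % n) % n) (m%n%n≡m%n m n) ⟩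
  (m % n ℕ.+ k % n) % n     ≡⟨ %-distribˡ-+ m k n ⟨
  (m ℕ.+ k) % n             ∎

module CyclicConvolution (n : ℕ) where

  infixl 6 _⊕_
  _⊕_ : Fin (suc n) → Fin (suc n) → Fin (suc n)
  a ⊕ b = (toℕ a ℕ.+ toℕ b) mod suc n

  toℕ-⊕ : ∀ a b → toℕ (a ⊕ b) ≡ (toℕ a ℕ.+ toℕ b) % suc n
  toℕ-⊕ a b = Finₚ.toℕ-fromℕ< _

  ⊕-comm : ∀ a b → a ⊕ b ≡ b ⊕ a
  ⊕-comm a b = cong (_mod suc n) (ℕₚ.+-comm (toℕ a) (toℕ b))

  ⊕-identityˡ : ∀ b → zero ⊕ b ≡ b
  ⊕-identityˡ b = Finₚ.toℕ-injective (trans (toℕ-⊕ zero b) (m<n⇒m%n≡m (Finₚ.toℕ<n b)))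

  infixl 6 _⊖_
  _⊖_ : Fin (suc n) → Fin (suc n) → Fin (suc n)
  r ⊖ s = (toℕ r ℕ.+ (suc n ℕ.∸ toℕ s)) mod suc n

  cpred : Fin (suc n) → Fin (suc n)
  cpred zero    = fromℕ n
  cpred (suc j) = inject₁ j

  toℕ-cpred : ∀ a → toℕ (cpred a) ≡ (toℕ a ℕ.+ n) % suc n
  toℕ-cpred zero    = trans (Finₚ.toℕ-fromℕ n) (sym (m<n⇒m%n≡m (ℕₚ.n<1+n n)))
  toℕ-cpred (suc j) = begin
    toℕ (inject₁ j)             ≡⟨ Finₚ.toℕ-inject₁ j ⟩
    toℕ j                       ≡⟨ m<n⇒m%n≡m (ℕₚ.m<n⇒m<1+n (Finₚ.toℕ<n j)) ⟨
    toℕ j % suc n               ≡⟨ [m+n]%n≡m%n (toℕ j) (suc n) ⟨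
    (toℕ j ℕ.+ suc n) % suc n   ≡⟨ cong (_% suc n) (ℕₚ.+-suc (toℕ j) n) ⟩
    (suc (toℕ j) ℕ.+ n) % suc n ∎

  cpred-⊕ : ∀ a b → cpred a ⊕ b ≡ cpred (a ⊕ b)
  cpred-⊕ a b = Finₚ.toℕ-injective (begin
    toℕ (cpred a ⊕ b)                          ≡⟨ toℕ-⊕ (cpred a) b ⟩
    (toℕ (cpred a) ℕ.+ toℕ b) % suc n          ≡⟨ cong (λ z → (z ℕ.+ toℕ b) % suc n) (toℕ-cpred a) ⟩
    ((toℕ a ℕ.+ n) % suc n ℕ.+ toℕ b) % suc n  ≡⟨ [m%n+k]%n≡[m+k]%n (toℕ a ℕ.+ n) (toℕ b) (suc n) ⟩
    (toℕ a ℕ.+ n ℕ.+ toℕ b) % suc n            ≡⟨ cong (_% suc n) (xy∙z≈xz∙y (toℕ a) n (toℕ b)) ⟩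
    (toℕ a ℕ.+ toℕ b ℕ.+ n) % suc n            ≡⟨ [m%n+k]%n≡[m+k]%n (toℕ a ℕ.+ toℕ b) n (suc n) ⟨
    ((toℕ a ℕ.+ toℕ b) % suc n ℕ.+ n) % suc n  ≡⟨ cong (λ z → (z ℕ.+ n) % suc n) (toℕ-⊕ a b) ⟨
    (toℕ (a ⊕ b) ℕ.+ n) % suc n                ≡⟨ toℕ-cpred (a ⊕ b) ⟨
    toℕ (cpred (a ⊕ b))                        ∎)

  cpred-injective : ∀ {a b} → cpred a ≡ cpred b → a ≡ b
  cpred-injective {zero}  {zero}  _  = refl
  cpred-injective {zero}  {suc j} eq = ⊥-elim (Finₚ.fromℕ≢inject₁ eq)
  cpred-injective {suc i} {zero}  eq = ⊥-elim (Finₚ.fromℕ≢inject₁ (sym eq))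
  cpred-injective {suc i} {suc j} eq = cong suc (Finₚ.inject₁-injective eq)

  sum-cpred : ∀ (f : Vector ℤ (suc n)) → ∑[ a < suc n ] f (cpred a) ≡ sum f
  sum-cpred f = begin
    f (fromℕ n) + ∑[ a < n ] f (inject₁ a) ≡⟨ ℤₚ.+-comm (f (fromℕ n)) _ ⟩
    ∑[ a < n ] f (inject₁ a) + f (fromℕ n) ≡⟨ sum-init-last f ⟨
    sum f                                  ∎

  [_⊕_≡_] : Fin (suc n) → Fin (suc n) → Fin (suc n) → ℤ
  [ a ⊕ b ≡ d ] = indicator (does (a ⊕ b Finₚ.≟ d))

  [⊕≡]-cpred : ∀ a b d → [ cpred a ⊕ b ≡ cpred d ] ≡ [ a ⊕ b ≡ d ]
  [⊕≡]-cpred a b d rewrite cpred-⊕ a b with cpred (a ⊕ b) Finₚ.≟ cpred d | a ⊕ b Finₚ.≟ d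
  ... | yes _  | yes _  = refl
  ... | no  _  | no  _  = refl
  ... | yes eq | no neq = ⊥-elim (neq (cpred-injective eq))
  ... | no neq | yes eq = ⊥-elim (neq (cong cpred eq))

  δ : Vector ℤ (suc n)
  δ zero    = + 1
  δ (suc _) = + 0

  infixl 7 _⊛_
  opaque
    _⊛_ : Vector ℤ (suc n) → Vector ℤ (suc n) → Vector ℤ (suc n)
    (f ⊛ g) d = ∑[ a < suc n ] ∑[ b < suc n ] ([ a ⊕ b ≡ d ] * (f a * g b))

    ⊛-cong : ∀ {f f′ g g′} → f ≗ f′ → g ≗ g′ → f ⊛ g ≗ f′ ⊛ g′
    ⊛-cong f≗f′ g≗g′ d = sum-cong-≗ λ a → sum-cong-≗ λ b →
      cong (λ x → [ a ⊕ b ≡ d ] * x) (cong₂ _*_ (f≗f′ a) (g≗g′ b))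

    ⊛-comm : ∀ f g → f ⊛ g ≗ g ⊛ f
    ⊛-comm f g d = begin
      ∑[ a < suc n ] ∑[ b < suc n ] ([ a ⊕ b ≡ d ] * (f a * g b))
        ≡⟨ sum-cong-≗ (λ a → sum-cong-≗ λ b →
             cong₂ (λ i x → indicator (does (i Finₚ.≟ d)) * x) (⊕-comm a b) (ℤₚ.*-comm (f a) (g b))) ⟩
      ∑[ a < suc n ] ∑[ b < suc n ] ([ b ⊕ a ≡ d ] * (g b * f a))
        ≡⟨ ∑-comm (λ a b → [ b ⊕ a ≡ d ] * (g b * f a)) ⟩
      ∑[ b < suc n ] ∑[ a < suc n ] ([ b ⊕ a ≡ d ] * (g b * f a)) ∎

    ⊛-identityˡ : ∀ g → δ ⊛ g ≗ g
    ⊛-identityˡ g d = begin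
      ∑[ b < suc n ] ([ zero ⊕ b ≡ d ] * (+ 1 * g b)) + ∑[ a < n ] ∑[ b < suc n ] ([ suc a ⊕ b ≡ d ] * (+ 0 * g b))
        ≡⟨ cong₂ _+_
             (sum-cong-≗ λ b → cong₂ (λ i x → indicator (does (i Finₚ.≟ d)) * x) (⊕-identityˡ b) (ℤₚ.*-identityˡ (g b)))
             (sum-cong-≗ λ a → sum-cong-≗ λ b → x*[0*y]≡0 [ suc a ⊕ b ≡ d ] (g b)) ⟩
      ∑[ b < suc n ] (indicator (does (b Finₚ.≟ d)) * g b) + ∑[ a < n ] ∑[ b < suc n ] (+ 0)
        ≡⟨ cong₂ _+_ (∑-indicator g d) (trans (sum-cong-≗ {n} λ _ → sum-replicate-zero (suc n)) (sum-replicate-zero n)) ⟩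
      g d + + 0 ≡⟨ ℤₚ.+-identityʳ (g d) ⟩
      g d       ∎

    ⊛-zeroˡ : ∀ g → (λ _ → + 0) ⊛ g ≗ λ _ → + 0
    ⊛-zeroˡ g d = begin
      ∑[ a < suc n ] ∑[ b < suc n ] ([ a ⊕ b ≡ d ] * (+ 0 * g b))
        ≡⟨ sum-cong-≗ (λ a → sum-cong-≗ λ b → x*[0*y]≡0 [ a ⊕ b ≡ d ] (g b)) ⟩
      ∑[ a < suc n ] ∑[ b < suc n ] (+ 0) ≡⟨ trans (sum-cong-≗ {suc n} λ _ → sum-replicate-zero (suc n)) (sum-replicate-zero (suc n)) ⟩
      + 0                                 ∎

    ⊛-distribʳ-+ : ∀ f g h → (λ x → f x + g x) ⊛ h ≗ λ d → (f ⊛ h) d + (g ⊛ h) d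
    ⊛-distribʳ-+ f g h d = begin
      ∑[ a < suc n ] ∑[ b < suc n ] ([ a ⊕ b ≡ d ] * ((f a + g a) * h b))
        ≡⟨ sum-cong-≗ (λ a → sum-cong-≗ λ b → distrib [ a ⊕ b ≡ d ] (f a) (g a) (h b)) ⟩
      ∑[ a < suc n ] ∑[ b < suc n ] ([ a ⊕ b ≡ d ] * (f a * h b) + [ a ⊕ b ≡ d ] * (g a * h b))
        ≡⟨ sum-cong-≗ (λ a → ∑-distrib-+ (λ b → [ a ⊕ b ≡ d ] * (f a * h b)) (λ b → [ a ⊕ b ≡ d ] * (g a * h b))) ⟩
      ∑[ a < suc n ] (∑[ b < suc n ] ([ a ⊕ b ≡ d ] * (f a * h b)) + ∑[ b < suc n ] ([ a ⊕ b ≡ d ] * (g a * h b)))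
        ≡⟨ ∑-distrib-+ (λ a → ∑[ b < suc n ] ([ a ⊕ b ≡ d ] * (f a * h b)))
                       (λ a → ∑[ b < suc n ] ([ a ⊕ b ≡ d ] * (g a * h b))) ⟩
      (f ⊛ h) d + (g ⊛ h) d ∎
      where
      distrib : ∀ χ x y z → χ * ((x + y) * z) ≡ χ * (x * z) + χ * (y * z)
      distrib = solve-∀

    ⊛-scaleˡ : ∀ c f g → (λ x → c * f x) ⊛ g ≗ λ d → c * (f ⊛ g) d
    ⊛-scaleˡ c f g d = begin
      ∑[ a < suc n ] ∑[ b < suc n ] ([ a ⊕ b ≡ d ] * (c * f a * g b))
        ≡⟨ sum-cong-≗ (λ a → sum-cong-≗ λ b → pull [ a ⊕ b ≡ d ] c (f a) (g b)) ⟩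
      ∑[ a < suc n ] ∑[ b < suc n ] (c * ([ a ⊕ b ≡ d ] * (f a * g b)))
        ≡⟨ sum-cong-≗ (λ a → *-distribˡ-sum c (λ b → [ a ⊕ b ≡ d ] * (f a * g b))) ⟨
      ∑[ a < suc n ] (c * ∑[ b < suc n ] ([ a ⊕ b ≡ d ] * (f a * g b)))
        ≡⟨ *-distribˡ-sum c (λ a → ∑[ b < suc n ] ([ a ⊕ b ≡ d ] * (f a * g b))) ⟨
      c * (f ⊛ g) d ∎
      where
      pull : ∀ χ c x y → χ * (c * x * y) ≡ c * (χ * (x * y))
      pull = solve-∀

    ⊛-cpred : ∀ f g → (f ∘ cpred) ⊛ g ≗ (f ⊛ g) ∘ cpred
    ⊛-cpred f g d = begin
      ∑[ a < suc n ] ∑[ b < suc n ] ([ a ⊕ b ≡ d ] * (f (cpred a) * g b))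
        ≡⟨ sum-cong-≗ (λ a → sum-cong-≗ λ b → cong (_* (f (cpred a) * g b)) ([⊕≡]-cpred a b d)) ⟨
      ∑[ a < suc n ] ∑[ b < suc n ] ([ cpred a ⊕ b ≡ cpred d ] * (f (cpred a) * g b))
        ≡⟨ sum-cpred (λ a → ∑[ b < suc n ] ([ a ⊕ b ≡ cpred d ] * (f a * g b))) ⟩
      (f ⊛ g) (cpred d) ∎

  lincomb : ∀ {m} → Vector ℤ m → Vector (Vector ℤ (suc n)) m → Vector ℤ (suc n)
  lincomb {m} c f x = ∑[ i < m ] (c i * f i x)

  ⊛-linearˡ : ∀ {m} c f g → lincomb {m} c f ⊛ g ≗ λ d → ∑[ i < m ] (c i * (f i ⊛ g) d)
  ⊛-linearˡ {zero}  c f g d = ⊛-zeroˡ g d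
  ⊛-linearˡ {suc m} c f g d = begin
    (lincomb c f ⊛ g) d
      ≡⟨ ⊛-distribʳ-+ (λ x → c zero * f zero x) (lincomb (c ∘ suc) (f ∘ suc)) g d ⟩
    ((λ x → c zero * f zero x) ⊛ g) d + (lincomb (c ∘ suc) (f ∘ suc) ⊛ g) d
      ≡⟨ cong₂ _+_ (⊛-scaleˡ (c zero) (f zero) g d) (⊛-linearˡ (c ∘ suc) (f ∘ suc) g d) ⟩
    ∑[ i < suc m ] (c i * (f i ⊛ g) d) ∎

  ⊛-bilinear : ∀ {m m′} c f c′ g → lincomb {m} c f ⊛ lincomb {m′} c′ g ≗
               λ d → ∑[ i < m ] (c i * ∑[ j < m′ ] (c′ j * (f i ⊛ g j) d))
  ⊛-bilinear c f c′ g d = begin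
    (lincomb c f ⊛ lincomb c′ g) d                     ≡⟨ ⊛-linearˡ c f (lincomb c′ g) d ⟩
    ∑[ i < _ ] (c i * (f i ⊛ lincomb c′ g) d)          ≡⟨ sum-cong-≗ (λ i → cong (c i *_) (linearʳ (f i))) ⟩
    ∑[ i < _ ] (c i * ∑[ j < _ ] (c′ j * (f i ⊛ g j) d)) ∎
    where
    linearʳ : ∀ h → (h ⊛ lincomb c′ g) d ≡ ∑[ j < _ ] (c′ j * (h ⊛ g j) d)
    linearʳ h = begin
      (h ⊛ lincomb c′ g) d ≡⟨ ⊛-comm h (lincomb c′ g) d ⟩
      (lincomb c′ g ⊛ h) d ≡⟨ ⊛-linearˡ c′ g h d ⟩
      ∑[ j < _ ] (c′ j * (g j ⊛ h) d) ≡⟨ sum-cong-≗ (λ j → cong (c′ j *_) (⊛-comm (g j) h d)) ⟩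
      ∑[ j < _ ] (c′ j * (h ⊛ g j) d) ∎


  [1+x]*_ : Vector ℤ (suc n) → Vector ℤ (suc n)
  ([1+x]* f) a = f a + f (cpred a)

  [1+x]*-cong : ∀ {f g} → f ≗ g → [1+x]* f ≗ [1+x]* g
  [1+x]*-cong f≗g a = cong₂ _+_ (f≗g a) (f≗g (cpred a))

  ⊛-[1+x]* : ∀ f g → ([1+x]* f) ⊛ g ≗ [1+x]* (f ⊛ g)
  ⊛-[1+x]* f g d = trans (⊛-distribʳ-+ f (f ∘ cpred) g d) (cong (_+_ ((f ⊛ g) d)) (⊛-cpred f g d))

  -- Rows are computed as Vecs so that evaluation shares the previous row.
  binomialRow : ℕ → Vec ℤ (suc n)
  binomialRow zero    = tabulate δ
  binomialRow (suc m) = tabulate ([1+x]* lookup (binomialRow m))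

  [1+x]^_ : ℕ → Vector ℤ (suc n)
  [1+x]^ m = lookup (binomialRow m)

  [1+x]^-zero : [1+x]^ 0 ≗ δ
  [1+x]^-zero = lookup∘tabulate δ

  [1+x]^-suc : ∀ m → [1+x]^ suc m ≗ [1+x]* ([1+x]^ m)
  [1+x]^-suc m = lookup∘tabulate ([1+x]* ([1+x]^ m))

  [1+x]^-+ : ∀ m m′ → [1+x]^ (m ℕ.+ m′) ≗ ([1+x]^ m) ⊛ ([1+x]^ m′)
  [1+x]^-+ zero    m′ d = sym (trans (⊛-cong {g = [1+x]^ m′} [1+x]^-zero (λ _ → refl) d) (⊛-identityˡ ([1+x]^ m′) d))
  [1+x]^-+ (suc m) m′ d = begin
    ([1+x]^ suc (m ℕ.+ m′)) d                ≡⟨ [1+x]^-suc (m ℕ.+ m′) d ⟩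
    ([1+x]* ([1+x]^ (m ℕ.+ m′))) d           ≡⟨ [1+x]*-cong ([1+x]^-+ m m′) d ⟩
    ([1+x]* (([1+x]^ m) ⊛ ([1+x]^ m′))) d    ≡⟨ ⊛-[1+x]* ([1+x]^ m) ([1+x]^ m′) d ⟨
    (([1+x]* ([1+x]^ m)) ⊛ ([1+x]^ m′)) d    ≡⟨ ⊛-cong {g = [1+x]^ m′} ([1+x]^-suc m) (λ _ → refl) d ⟨
    (([1+x]^ suc m) ⊛ ([1+x]^ m′)) d         ∎

binomℤ-pascal : ∀ n z → binomℤ (suc n) z ≡ binomℤ n z + binomℤ n (z - + 1)
binomℤ-pascal n (+ zero)  = refl
binomℤ-pascal n (+ suc k) = cong +_ (trans (sym (nCk+nC[k+1]≡[n+1]C[k+1] n k)) (ℕₚ.+-comm (n C k) (n C suc k)))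
binomℤ-pascal n -[1+ k ]  = refl

[k+1]*[n+1]C[k+1]≡[n+1]*nCk : ∀ n k → suc k ℕ.* (suc n C suc k) ≡ suc n ℕ.* (n C k)
[k+1]*[n+1]C[k+1]≡[n+1]*nCk zero    zero    = refl
[k+1]*[n+1]C[k+1]≡[n+1]*nCk zero    (suc k) = ℕₚ.*-zeroʳ (2 ℕ.+ k)
[k+1]*[n+1]C[k+1]≡[n+1]*nCk (suc n) zero    = begin
  1 ℕ.* ((2 ℕ.+ n) C 1) ≡⟨ ℕₚ.*-identityˡ ((2 ℕ.+ n) C 1) ⟩
  (2 ℕ.+ n) C 1         ≡⟨ nC1≡n (2 ℕ.+ n) ⟩
  2 ℕ.+ n             ≡⟨ ℕₚ.*-identityʳ (2 ℕ.+ n) ⟨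
  (2 ℕ.+ n) ℕ.* 1     ∎
[k+1]*[n+1]C[k+1]≡[n+1]*nCk (suc n) (suc k) = begin
  (2 ℕ.+ k) ℕ.* ((2 ℕ.+ n) C (2 ℕ.+ k))            ≡⟨ cong ((2 ℕ.+ k) ℕ.*_) (nCk+nC[k+1]≡[n+1]C[k+1] (suc n) (suc k)) ⟨
  (2 ℕ.+ k) ℕ.* (c ℕ.+ c′)                        ≡⟨ expand k c c′ ⟩
  (1 ℕ.+ k) ℕ.* c ℕ.+ c ℕ.+ (2 ℕ.+ k) ℕ.* c′       ≡⟨ cong₂ (λ x y → x ℕ.+ c ℕ.+ y) ([k+1]*[n+1]C[k+1]≡[n+1]*nCk n k)
                                                                                   ([k+1]*[n+1]C[k+1]≡[n+1]*nCk n (suc k)) ⟩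
  (1 ℕ.+ n) ℕ.* b ℕ.+ c ℕ.+ (1 ℕ.+ n) ℕ.* b′       ≡⟨ collect n b b′ c ⟩
  (1 ℕ.+ n) ℕ.* (b ℕ.+ b′) ℕ.+ c                  ≡⟨ cong (λ x → (1 ℕ.+ n) ℕ.* x ℕ.+ c) (nCk+nC[k+1]≡[n+1]C[k+1] n k) ⟩
  (1 ℕ.+ n) ℕ.* c ℕ.+ c                           ≡⟨ absorb n c ⟩
  (2 ℕ.+ n) ℕ.* c                                 ∎
  where
  b = n C k
  b′ = n C suc k
  c = suc n C suc k
  c′ = suc n C suc (suc k)
  expand : ∀ k c c′ → (2 ℕ.+ k) ℕ.* (c ℕ.+ c′) ≡ (1 ℕ.+ k) ℕ.* c ℕ.+ c ℕ.+ (2 ℕ.+ k) ℕ.* c′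
  expand = ℕ-Solver.solve-∀
  collect : ∀ n b b′ c → (1 ℕ.+ n) ℕ.* b ℕ.+ c ℕ.+ (1 ℕ.+ n) ℕ.* b′ ≡ (1 ℕ.+ n) ℕ.* (b ℕ.+ b′) ℕ.+ c
  collect = ℕ-Solver.solve-∀
  absorb : ∀ n c → (1 ℕ.+ n) ℕ.* c ℕ.+ c ≡ (2 ℕ.+ n) ℕ.* c
  absorb = ℕ-Solver.solve-∀

binomℤ-absorb : ∀ n z → z * binomℤ (suc n) z ≡ + suc n * binomℤ n (z - + 1)
binomℤ-absorb n (+ zero)  = sym (ℤₚ.*-zeroʳ (+ suc n))
binomℤ-absorb n (+ suc k) = begin
  + suc k * + (suc n C suc k)       ≡⟨ ℤₚ.pos-* (suc k) (suc n C suc k) ⟨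
  + (suc k ℕ.* (suc n C suc k))     ≡⟨ cong +_ ([k+1]*[n+1]C[k+1]≡[n+1]*nCk n k) ⟩
  + (suc n ℕ.* (n C k))             ≡⟨ ℤₚ.pos-* (suc n) (n C k) ⟩
  + suc n * + (n C k)               ∎
binomℤ-absorb n -[1+ k ]  = trans (ℤₚ.*-zeroʳ -[1+ k ]) (sym (ℤₚ.*-zeroʳ (+ suc n)))

binomℤ-above : ∀ n {m} → n ℕ.< m → binomℤ n (+ m) ≡ + 0
binomℤ-above n n<m = cong +_ (k>n⇒nCk≡0 n<m)

binomℤ-below : ∀ n {a b} → a ℕ.< b → binomℤ n (+ a - + b) ≡ + 0
binomℤ-below n {a} {suc b} (s≤s a≤b) = begin
  binomℤ n (+ a - + suc b)      ≡⟨ cong (binomℤ n) (trans (ℤₚ.m-n≡m⊖n a (suc b)) (ℤₚ.⊖-< (s≤s a≤b))) ⟩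
  binomℤ n (- + (suc b ℕ.∸ a))  ≡⟨ cong (λ c → binomℤ n (- + c)) (ℕₚ.+-∸-assoc 1 a≤b) ⟩
  binomℤ n -[1+ b ℕ.∸ a ]       ∎

window : ℕ → ℕ → (ℤ → ℤ) → ℤ
window L N h = ∑[ j < N ] h (+ toℕ j - + L)

window-head : ∀ L N h → window (suc L) (suc N) h ≡ h -[1+ L ] + window L N h
window-head L N h = cong (_+_ (h -[1+ L ])) (sum-cong-≗ {N} λ j → cong h (cancel (+ toℕ j) (+ L)))
  where
  cancel : ∀ x y → + 1 + x - (+ 1 + y) ≡ x - y
  cancel = solve-∀

window-last : ∀ L N h → window L (suc N) h ≡ window L N h + h (+ N - + L)
window-last L N h = trans (sum-init-last {N} (λ j → h (+ toℕ j - + L)))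
  (cong₂ _+_ (sum-cong-≗ {N} λ j → cong (λ x → h (+ x - + L)) (Finₚ.toℕ-inject₁ j))
             (cong (λ x → h (+ x - + L)) (Finₚ.toℕ-fromℕ N)))

symSum : ℕ → (ℤ → ℤ) → ℤ
symSum L = window L (suc (L ℕ.+ L))

symSum-point : ∀ L h → (∀ m → h (+ suc m) ≡ + 0) → (∀ m → h -[1+ m ] ≡ + 0) → symSum L h ≡ h (+ 0)
symSum-point zero    h _  _  = ℤₚ.+-identityʳ (h (+ 0))
symSum-point (suc L) h h⁺ h⁻ = begin
  window (suc L) (suc (suc (L ℕ.+ suc L))) h                   ≡⟨ window-head L (suc (L ℕ.+ suc L)) h ⟩
  h -[1+ L ] + window L (suc (L ℕ.+ suc L)) h                  ≡⟨ cong (λ N → h -[1+ L ] + window L (suc N) h) (ℕₚ.+-suc L L) ⟩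
  h -[1+ L ] + window L (suc (suc (L ℕ.+ L))) h                ≡⟨ cong (_+_ (h -[1+ L ])) (window-last L (suc (L ℕ.+ L)) h) ⟩
  h -[1+ L ] + (symSum L h + h (+ suc (L ℕ.+ L) - + L))        ≡⟨ cong₂ (λ x y → x + (symSum L h + h y)) (h⁻ L) top ⟩
  + 0 + (symSum L h + h (+ suc L))                             ≡⟨ cong₂ (λ x y → + 0 + (x + y)) (symSum-point L h h⁺ h⁻) (h⁺ L) ⟩
  + 0 + (h (+ 0) + + 0)                                        ≡⟨ trans (ℤₚ.+-identityˡ _) (ℤₚ.+-identityʳ (h (+ 0))) ⟩
  h (+ 0)                                                      ∎
  where
  top : + suc (L ℕ.+ L) - + L ≡ + suc L
  top = trans (cong (λ x → + 1 + x - + L) (ℤₚ.pos-+ L L)) (cancel (+ L))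
    where
    cancel : ∀ x → + 1 + (x + x) - x ≡ + 1 + x
    cancel = solve-∀

symSum-shift : ∀ L h → symSum L (λ α → h (α - + 1)) + h (+ L) ≡ h -[1+ L ] + symSum L h
symSum-shift L h = begin
  window L N (λ α → h (α - + 1)) + h (+ L)
    ≡⟨ cong₂ _+_ (sum-cong-≗ {N} λ j → cong h (reassoc (+ toℕ j) (+ L))) (cong h (sym top)) ⟩
  window (suc L) N h + h (+ N - + suc L) ≡⟨ window-last (suc L) N h ⟨
  window (suc L) (suc N) h               ≡⟨ window-head L N h ⟩
  h -[1+ L ] + symSum L h                ∎
  where
  N = suc (L ℕ.+ L)
  reassoc : ∀ x y → x - y - + 1 ≡ x - (+ 1 + y)
  reassoc = solve-∀
  top : + N - + suc L ≡ + L
  top = trans (cong (λ x → + 1 + x - (+ 1 + + L)) (ℤₚ.pos-+ L L)) (cancel (+ L))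
    where
    cancel : ∀ x → + 1 + (x + x) - (+ 1 + x) ≡ x
    cancel = solve-∀

sumℤ-applyUpTo : ∀ {A : Set} (g : A → ℤ) f N → sumℤ (map g (applyUpTo f N)) ≡ ∑[ j < N ] g (f (toℕ j))
sumℤ-applyUpTo g f zero    = refl
sumℤ-applyUpTo g f (suc N) = cong (_+_ (g (f 0))) (sumℤ-applyUpTo g (f ∘ suc) N)

T-symSum : ∀ k i r s → T k i r s ≡ symSum (suc i) (λ α → α * binomℤ i (α * + k + + suc (toℕ r) - + suc (toℕ s)))
T-symSum k i r s = begin
  sumℤ (map g (map (λ j → + j - + suc i) (applyUpTo (λ j → j) N)))
    ≡⟨ cong sumℤ (map-∘ {g = g} {f = λ j → + j - + suc i} (applyUpTo (λ j → j) N)) ⟨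
  sumℤ (map (λ j → g (+ j - + suc i)) (applyUpTo (λ j → j) N))
    ≡⟨ sumℤ-applyUpTo (λ j → g (+ j - + suc i)) (λ j → j) N ⟩
  window (suc i) N g ≡⟨ cong (λ N → window (suc i) (suc (suc N)) g) count ⟩
  symSum (suc i) g   ∎
  where
  N = suc (suc (2 ℕ.* i ℕ.+ 1))
  g : ℤ → ℤ
  g α = α * binomℤ i (α * + k + + suc (toℕ r) - + suc (toℕ s))
  count : 2 ℕ.* i ℕ.+ 1 ≡ i ℕ.+ suc i
  count = trans (ℕₚ.+-comm (2 ℕ.* i) 1) (trans (cong (λ x → suc (i ℕ.+ x)) (ℕₚ.+-identityʳ i)) (sym (ℕₚ.+-suc i i)))

module BinomialSections (n : ℕ) where

  open CyclicConvolution n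

  Σbinom : ℕ → ℕ → ℤ → ℤ
  Σbinom L m z = symSum L (λ α → binomℤ m (α * + suc n + z))

  Σαbinom : ℕ → ℕ → ℤ → ℤ
  Σαbinom L m z = symSum L (λ α → α * binomℤ m (α * + suc n + z))

  Σbinom-pascal : ∀ L m z → Σbinom L (suc m) z ≡ Σbinom L m z + Σbinom L m (z - + 1)
  Σbinom-pascal L m z = trans (sum-cong-≗ {N} λ j →
      trans (binomℤ-pascal m (α j * + suc n + z))
            (cong (λ x → binomℤ m (α j * + suc n + z) + binomℤ m x) (ℤₚ.+-assoc (α j * + suc n) z (- + 1))))
    (∑-distrib-+ {N} (λ j → binomℤ m (α j * + suc n + z)) (λ j → binomℤ m (α j * + suc n + (z - + 1))))
    where
    N = suc (L ℕ.+ L)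
    α : Fin N → ℤ
    α j = + toℕ j - + L

  Σαbinom-absorb : ∀ L m z → + suc n * Σαbinom L (suc m) z + z * Σbinom L (suc m) z ≡ + suc m * Σbinom L m (z - + 1)
  Σαbinom-absorb L m z = begin
    + suc n * ∑[ j < N ] (α j * C (suc m) j z) + z * ∑[ j < N ] C (suc m) j z
      ≡⟨ cong₂ _+_ (*-distribˡ-sum (+ suc n) (λ j → α j * C (suc m) j z)) (*-distribˡ-sum z (λ j → C (suc m) j z)) ⟩
    ∑[ j < N ] (+ suc n * (α j * C (suc m) j z)) + ∑[ j < N ] (z * C (suc m) j z)
      ≡⟨ ∑-distrib-+ (λ j → + suc n * (α j * C (suc m) j z)) (λ j → z * C (suc m) j z) ⟨
    ∑[ j < N ] (+ suc n * (α j * C (suc m) j z) + z * C (suc m) j z)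
      ≡⟨ sum-cong-≗ {N} (λ j → trans (collect (+ suc n) (α j) z (C (suc m) j z)) (binomℤ-absorb m (α j * + suc n + z))) ⟩
    ∑[ j < N ] (+ suc m * binomℤ m (α j * + suc n + z - + 1))
      ≡⟨ sum-cong-≗ {N} (λ j → cong (λ x → + suc m * binomℤ m x) (ℤₚ.+-assoc (α j * + suc n) z (- + 1))) ⟩
    ∑[ j < N ] (+ suc m * C m j (z - + 1))
      ≡⟨ *-distribˡ-sum (+ suc m) (λ j → C m j (z - + 1)) ⟨
    + suc m * Σbinom L m (z - + 1) ∎
    where
    N = suc (L ℕ.+ L)
    α : Fin N → ℤ
    α j = + toℕ j - + L
    C : ℕ → Fin N → ℤ → ℤ
    C m j z = binomℤ m (α j * + suc n + z)
    collect : ∀ k a z c → k * (a * c) + z * c ≡ (a * k + z) * c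
    collect = solve-∀

  binomℤ-ak+e-above : ∀ m a e → m ℕ.< a ℕ.* suc n → binomℤ m (+ a * + suc n + + e) ≡ + 0
  binomℤ-ak+e-above m a e m<ak = begin
    binomℤ m (+ a * + suc n + + e)   ≡⟨ cong (λ x → binomℤ m (x + + e)) (ℤₚ.pos-* a (suc n)) ⟨
    binomℤ m (+ (a ℕ.* suc n ℕ.+ e)) ≡⟨ binomℤ-above m (ℕₚ.<-≤-trans m<ak (ℕₚ.m≤m+n (a ℕ.* suc n) e)) ⟩
    + 0                              ∎

  binomℤ-ak+e-below : ∀ m a e → e ℕ.< suc n → binomℤ m (-[1+ a ] * + suc n + + e) ≡ + 0
  binomℤ-ak+e-below m a e e<k = begin
    binomℤ m (- + suc a * + suc n + + e) ≡⟨ cong (binomℤ m) (swap (+ suc a) (+ suc n) (+ e)) ⟩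
    binomℤ m (+ e - + suc a * + suc n)   ≡⟨ cong (λ x → binomℤ m (+ e - x)) (ℤₚ.pos-* (suc a) (suc n)) ⟨
    binomℤ m (+ e - + (suc a ℕ.* suc n)) ≡⟨ binomℤ-below m (ℕₚ.<-≤-trans e<k (ℕₚ.m≤m+n (suc n) (a ℕ.* suc n))) ⟩
    + 0                                  ∎
    where
    swap : ∀ x y z → - x * y + z ≡ z - x * y
    swap = solve-∀

  Σbinom-wrap : ∀ L m e → m ℕ.< L ℕ.* suc n → e ℕ.< suc n → Σbinom L m (+ e - + suc n) ≡ Σbinom L m (+ e)
  Σbinom-wrap L m e m<Lk e<k = begin
    Σbinom L m (+ e - + suc n)
      ≡⟨ sum-cong-≗ {suc (L ℕ.+ L)} (λ j → cong (binomℤ m) (shift (+ toℕ j - + L) (+ suc n) (+ e))) ⟩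
    symSum L (λ α → h (α - + 1))                ≡⟨ ℤₚ.+-identityʳ _ ⟨
    symSum L (λ α → h (α - + 1)) + + 0          ≡⟨ cong (_+_ (symSum L (λ α → h (α - + 1)))) (binomℤ-ak+e-above m L e m<Lk) ⟨
    symSum L (λ α → h (α - + 1)) + h (+ L)      ≡⟨ symSum-shift L h ⟩
    h -[1+ L ] + symSum L h                     ≡⟨ cong (_+ symSum L h) (binomℤ-ak+e-below m L e e<k) ⟩
    + 0 + symSum L h                            ≡⟨ ℤₚ.+-identityˡ _ ⟩
    Σbinom L m (+ e)                            ∎
    where
    h : ℤ → ℤ
    h α = binomℤ m (α * + suc n + + e)
    shift : ∀ a k e → a * k + (e - k) ≡ (a - + 1) * k + e
    shift = solve-∀

  Σbinom-zero : ∀ L e → Σbinom L 0 (+ toℕ e) ≡ δ e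
  Σbinom-zero L e = trans
    (symSum-point L (λ α → binomℤ 0 (α * + suc n + + toℕ e))
      (λ a → binomℤ-ak+e-above 0 (suc a) (toℕ e) ℕ.z<s)
      (λ a → binomℤ-ak+e-below 0 a (toℕ e) (Finₚ.toℕ<n e)))
    (binom0 e)
    where
    binom0 : ∀ e → binomℤ 0 (+ 0 * + suc n + + toℕ e) ≡ δ e
    binom0 zero    = refl
    binom0 (suc e) = refl

  Σbinom≡[1+x]^ : ∀ L m → m ℕ.< L ℕ.* suc n → ∀ e → Σbinom L m (+ toℕ e) ≡ ([1+x]^ m) e
  Σbinom≡[1+x]^ L zero    _    e = trans (Σbinom-zero L e) (sym ([1+x]^-zero e))
  Σbinom≡[1+x]^ L (suc m) m<Lk e = begin
    Σbinom L (suc m) (+ toℕ e)                              ≡⟨ Σbinom-pascal L m (+ toℕ e) ⟩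
    Σbinom L m (+ toℕ e) + Σbinom L m (+ toℕ e - + 1)       ≡⟨ cong₂ _+_ (Σbinom≡[1+x]^ L m m<Lk′ e) (previous e) ⟩
    ([1+x]^ m) e + ([1+x]^ m) (cpred e)                     ≡⟨ [1+x]^-suc m e ⟨
    ([1+x]^ suc m) e                                        ∎
    where
    m<Lk′ = ℕₚ.<-trans (ℕₚ.n<1+n m) m<Lk
    minus-one : ∀ x → x - (+ 1 + x) ≡ - + 1
    minus-one = solve-∀
    previous : ∀ e → Σbinom L m (+ toℕ e - + 1) ≡ ([1+x]^ m) (cpred e)
    previous zero    = begin
      Σbinom L m (- + 1)               ≡⟨ cong (Σbinom L m) (minus-one (+ n)) ⟨
      Σbinom L m (+ n - + suc n)       ≡⟨ Σbinom-wrap L m n m<Lk′ (ℕₚ.n<1+n n) ⟩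
      Σbinom L m (+ n)                 ≡⟨ cong (Σbinom L m ∘ +_) (Finₚ.toℕ-fromℕ n) ⟨
      Σbinom L m (+ toℕ (fromℕ n))     ≡⟨ Σbinom≡[1+x]^ L m m<Lk′ (fromℕ n) ⟩
      ([1+x]^ m) (fromℕ n)             ∎
    previous (suc e) = begin
      Σbinom L m (+ toℕ e)             ≡⟨ cong (Σbinom L m ∘ +_) (Finₚ.toℕ-inject₁ e) ⟨
      Σbinom L m (+ toℕ (inject₁ e))   ≡⟨ Σbinom≡[1+x]^ L m m<Lk′ (inject₁ e) ⟩
      ([1+x]^ m) (inject₁ e)           ∎

  Σbinom-difference : ∀ L m → m ℕ.< L ℕ.* suc n → ∀ r s → Σbinom L m (+ toℕ r - + toℕ s) ≡ ([1+x]^ m) (r ⊖ s)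
  Σbinom-difference L m m<Lk r s with toℕ s ℕₚ.≤? toℕ r
  ... | yes s≤r = begin
    Σbinom L m (+ toℕ r - + toℕ s)     ≡⟨ cong (Σbinom L m) (trans (ℤₚ.m-n≡m⊖n (toℕ r) (toℕ s)) (ℤₚ.⊖-≥ s≤r)) ⟩
    Σbinom L m (+ (toℕ r ℕ.∸ toℕ s))   ≡⟨ cong (Σbinom L m ∘ +_) toℕ-r⊖s ⟨
    Σbinom L m (+ toℕ (r ⊖ s))         ≡⟨ Σbinom≡[1+x]^ L m m<Lk (r ⊖ s) ⟩
    ([1+x]^ m) (r ⊖ s)                 ∎
    where
    rearrange : toℕ r ℕ.+ (suc n ℕ.∸ toℕ s) ≡ toℕ r ℕ.∸ toℕ s ℕ.+ suc n
    rearrange = begin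
      toℕ r ℕ.+ (suc n ℕ.∸ toℕ s)                   ≡⟨ cong (ℕ._+ (suc n ℕ.∸ toℕ s)) (ℕₚ.m∸n+n≡m s≤r) ⟨
      toℕ r ℕ.∸ toℕ s ℕ.+ toℕ s ℕ.+ (suc n ℕ.∸ toℕ s) ≡⟨ ℕₚ.+-assoc (toℕ r ℕ.∸ toℕ s) (toℕ s) _ ⟩
      toℕ r ℕ.∸ toℕ s ℕ.+ (toℕ s ℕ.+ (suc n ℕ.∸ toℕ s)) ≡⟨ cong (toℕ r ℕ.∸ toℕ s ℕ.+_) (ℕₚ.m+[n∸m]≡n (ℕₚ.<⇒≤ (Finₚ.toℕ<n s))) ⟩
      toℕ r ℕ.∸ toℕ s ℕ.+ suc n                     ∎
    toℕ-r⊖s : toℕ (r ⊖ s) ≡ toℕ r ℕ.∸ toℕ s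
    toℕ-r⊖s = begin
      toℕ (r ⊖ s)                                   ≡⟨ Finₚ.toℕ-fromℕ< _ ⟩
      (toℕ r ℕ.+ (suc n ℕ.∸ toℕ s)) % suc n         ≡⟨ cong (_% suc n) rearrange ⟩
      (toℕ r ℕ.∸ toℕ s ℕ.+ suc n) % suc n           ≡⟨ [m+n]%n≡m%n (toℕ r ℕ.∸ toℕ s) (suc n) ⟩
      (toℕ r ℕ.∸ toℕ s) % suc n                     ≡⟨ m<n⇒m%n≡m (ℕₚ.≤-<-trans (ℕₚ.m∸n≤m (toℕ r) (toℕ s)) (Finₚ.toℕ<n r)) ⟩
      toℕ r ℕ.∸ toℕ s                               ∎
  ... | no s≰r = begin
    Σbinom L m (+ toℕ r - + toℕ s)                       ≡⟨ cong (Σbinom L m) unwrap ⟩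
    Σbinom L m (+ toℕ (r ⊖ s) - + suc n)                 ≡⟨ Σbinom-wrap L m (toℕ (r ⊖ s)) m<Lk (Finₚ.toℕ<n (r ⊖ s)) ⟩
    Σbinom L m (+ toℕ (r ⊖ s))                           ≡⟨ Σbinom≡[1+x]^ L m m<Lk (r ⊖ s) ⟩
    ([1+x]^ m) (r ⊖ s)                                   ∎
    where
    s≤k = ℕₚ.<⇒≤ (Finₚ.toℕ<n s)
    r+[k-s]<k : toℕ r ℕ.+ (suc n ℕ.∸ toℕ s) ℕ.< suc n
    r+[k-s]<k = subst (toℕ r ℕ.+ (suc n ℕ.∸ toℕ s) ℕ.<_) (ℕₚ.m+[n∸m]≡n s≤k) (ℕₚ.+-monoˡ-< (suc n ℕ.∸ toℕ s) (ℕₚ.≰⇒> s≰r))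
    toℕ-r⊖s : toℕ (r ⊖ s) ≡ toℕ r ℕ.+ (suc n ℕ.∸ toℕ s)
    toℕ-r⊖s = trans (Finₚ.toℕ-fromℕ< _) (m<n⇒m%n≡m r+[k-s]<k)
    add-subtract : ∀ x y k → x - y ≡ x + (k - y) - k
    add-subtract = solve-∀
    unwrap : + toℕ r - + toℕ s ≡ + toℕ (r ⊖ s) - + suc n
    unwrap = begin
      + toℕ r - + toℕ s                                  ≡⟨ add-subtract (+ toℕ r) (+ toℕ s) (+ suc n) ⟩
      + toℕ r + (+ suc n - + toℕ s) - + suc n            ≡⟨ cong (λ x → + toℕ r + x - + suc n) (trans (ℤₚ.m-n≡m⊖n (suc n) (toℕ s)) (ℤₚ.⊖-≥ s≤k)) ⟩
      + toℕ r + + (suc n ℕ.∸ toℕ s) - + suc n            ≡⟨ cong (_- + suc n) (ℤₚ.pos-+ (toℕ r) (suc n ℕ.∸ toℕ s)) ⟨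
      + (toℕ r ℕ.+ (suc n ℕ.∸ toℕ s)) - + suc n          ≡⟨ cong (λ x → + x - + suc n) toℕ-r⊖s ⟨
      + toℕ (r ⊖ s) - + suc n                            ∎

  T-formula : ∀ m r s → + suc n * T (suc n) (suc m) r s ≡
    + suc m * ([1+x]^ m) (cpred (r ⊖ s)) - (+ toℕ r - + toℕ s) * ([1+x]^ suc m) (r ⊖ s)
  T-formula m r s = begin
    + suc n * T (suc n) (suc m) r s               ≡⟨ cong (+ suc n *_) T≡Σαbinom ⟩
    + suc n * Σαbinom L (suc m) d                 ≡⟨ move (Σαbinom-absorb L m d) ⟩
    + suc m * Σbinom L m (d - + 1) - d * Σbinom L (suc m) d
      ≡⟨ cong₂ (λ x y → + suc m * x - d * y) previous (Σbinom-difference L (suc m) 1+m<Lk r s) ⟩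
    + suc m * ([1+x]^ m) (cpred e) - d * ([1+x]^ suc m) e ∎
    where
    L = suc (suc m)
    d = + toℕ r - + toℕ s
    e = r ⊖ s
    1+m<Lk : suc m ℕ.< L ℕ.* suc n
    1+m<Lk = ℕₚ.<-≤-trans (ℕₚ.n<1+n (suc m)) (ℕₚ.m≤m*n L (suc n))
    m<Lk = ℕₚ.<-trans (ℕₚ.n<1+n m) 1+m<Lk
    shift : ∀ a x y → a + (+ 1 + x) - (+ 1 + y) ≡ a + (x - y)
    shift = solve-∀
    T≡Σαbinom : T (suc n) (suc m) r s ≡ Σαbinom L (suc m) d
    T≡Σαbinom = trans (T-symSum (suc n) (suc m) r s) (sum-cong-≗ {suc (L ℕ.+ L)} λ j →
      let α = + toℕ j - + L in cong (λ x → α * binomℤ (suc m) x) (shift (α * + suc n) (+ toℕ r) (+ toℕ s)))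
    move : ∀ {x y z} → x + y ≡ z → x ≡ z - y
    move {x} {y} refl = add-sub x y
      where
      add-sub : ∀ x y → x ≡ x + y - y
      add-sub = solve-∀
    previous : Σbinom L m (d - + 1) ≡ ([1+x]^ m) (cpred e)
    previous = ∙-cancelˡ (Σbinom L m d) _ _ (begin
      Σbinom L m d + Σbinom L m (d - + 1)  ≡⟨ Σbinom-pascal L m d ⟨
      Σbinom L (suc m) d                   ≡⟨ Σbinom-difference L (suc m) 1+m<Lk r s ⟩
      ([1+x]^ suc m) e                     ≡⟨ [1+x]^-suc m e ⟩
      ([1+x]^ m) e + ([1+x]^ m) (cpred e)  ≡⟨ cong (_+ ([1+x]^ m) (cpred e)) (Σbinom-difference L m m<Lk r s) ⟨
      Σbinom L m d + ([1+x]^ m) (cpred e)  ∎)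

coprime-2^-3 : ∀ j → ℕC.Coprime (2 ^ j) 3
coprime-2^-3 zero    (i∣1 , _)        = ∣1⇒≡1 i∣1
coprime-2^-3 (suc j) (i∣2^[1+j] , i∣3) = coprime-2^-3 j (ℕC.coprime-divisor i-coprime-2 i∣2^[1+j] , i∣3)
  where
  i-coprime-2 : ℕC.Coprime _ 2
  i-coprime-2 (x∣i , x∣2) = ℕC.gcd≡1⇒coprime {3} {2} refl (∣-trans x∣i i∣3 , x∣2)

2^j∣3x⇒2^j∣x : ∀ j {x} → + (2 ^ j) ∣ˢ + 3 * x → + (2 ^ j) ∣ˢ x
2^j∣3x⇒2^j∣x j {x} 2^j∣3x = ∣ᵤ⇒∣ (ℤC.coprime-divisor (+ (2 ^ j)) (+ 3) x (coprime-2^-3 j) (∣⇒∣ᵤ 2^j∣3x))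

pow-split : ∀ a i → + (2 ^ (a ℕ.+ i)) ≡ + (2 ^ a) * + (2 ^ i)
pow-split a i = trans (cong +_ (ℕₚ.^-distribˡ-+-* 2 a i)) (ℤₚ.pos-* (2 ^ a) (2 ^ i))

≡+quotient : ∀ {m x y} (m∣x-y : m ∣ˢ x - y) → x ≡ y + quotient m∣x-y * m
≡+quotient {m} {x} {y} (divides q eq) = begin
  x           ≡⟨ shift x y ⟩
  y + (x - y) ≡⟨ cong (_+_ y) eq ⟩
  y + q * m   ∎
  where
  shift : ∀ x y → x ≡ y + (x - y)
  shift = solve-∀

1≤24*2^j : ∀ j → 1 ℕ.≤ 24 ℕ.* 2 ^ j
1≤24*2^j j = ℕₚ.≤-trans (ℕₚ.m^n>0 2 j) (ℕₚ.m≤n*m (2 ^ j) 24)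

-- The hypotheses are the expansions of (P + tQ + 64tE)² and (P + tQ + 64tE)(R + 8F) given by
-- ⊛-bilinear, with the multiplication table of P, Q, R substituted.
square-identity : ∀ {s t p q v w pe qe ee aa} → t ≡ + 16 * s →
  + 3 * (+ 3 * aa) ≡
    + 1 * (+ 1 * (+ 3 * p) + (t * (+ 3 * q + v * + 64) + (+ 64 * t * pe + + 0))) +
    (t * (+ 1 * (+ 3 * q + v * + 64) + (t * (w * + 8) + (+ 64 * t * qe + + 0))) +
    (+ 64 * t * (+ 1 * pe + (t * qe + (+ 64 * t * ee + + 0))) + + 0)) →
  + 3 * (+ 3 * aa - (p + + 2 * t * q)) ≡ (v + s * w + pe + t * qe + + 32 * t * ee) * (+ 128 * t)
square-identity {s} {p = p} {q} {v} {w} {pe} {qe} {ee} {aa} refl h = begin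
  + 3 * (+ 3 * aa - (p + + 2 * t * q))           ≡⟨ distrib (+ 3 * aa) p t q ⟩
  + 3 * (+ 3 * aa) - + 3 * p - + 6 * t * q      ≡⟨ cong (λ x → x - + 3 * p - + 6 * t * q) h ⟩
  _                                              ≡⟨ collect s p q v w pe qe ee ⟩
  (v + s * w + pe + t * qe + + 32 * t * ee) * (+ 128 * t) ∎
  where
  t = + 16 * s
  distrib : ∀ x p t q → + 3 * (x - (p + + 2 * t * q)) ≡ + 3 * x - + 3 * p - + 6 * t * q
  distrib = solve-∀
  collect : ∀ s p q v w pe qe ee → let t = + 16 * s in
    + 1 * (+ 1 * (+ 3 * p) + (t * (+ 3 * q + v * + 64) + (+ 64 * t * pe + + 0))) +
    (t * (+ 1 * (+ 3 * q + v * + 64) + (t * (w * + 8) + (+ 64 * t * qe + + 0))) +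
    (+ 64 * t * (+ 1 * pe + (t * qe + (+ 64 * t * ee + + 0))) + + 0)) - + 3 * p - + 6 * t * q
    ≡ (v + s * w + pe + t * qe + + 32 * t * ee) * (+ 128 * t)
  collect = solve-∀

product-identity : ∀ {s t r u pr pf qr qf er ef ab} → t ≡ + 16 * s → pr ≡ + 3 * r + u * + 8 →
  + 3 * ab ≡ + 1 * (+ 1 * pr + (+ 8 * pf + + 0)) + (t * (+ 1 * qr + (+ 8 * qf + + 0)) + (+ 64 * t * (+ 1 * er + (+ 8 * ef + + 0)) + + 0)) →
  + 3 * (ab - r) ≡ (u + pf + + 2 * s * qr + t * qf + + 8 * t * er + + 64 * t * ef) * + 8
product-identity {s} {r = r} {u} {pf = pf} {qr} {qf} {er} {ef} {ab} refl refl h = begin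
  + 3 * (ab - r)         ≡⟨ distrib ab r ⟩
  + 3 * ab - + 3 * r     ≡⟨ cong (_- + 3 * r) h ⟩
  _                      ≡⟨ collect s r u pf qr qf er ef ⟩
  (u + pf + + 2 * s * qr + t * qf + + 8 * t * er + + 64 * t * ef) * + 8 ∎
  where
  t = + 16 * s
  distrib : ∀ x r → + 3 * (x - r) ≡ + 3 * x - + 3 * r
  distrib = solve-∀
  collect : ∀ s r u pf qr qf er ef → let t = + 16 * s in
    + 1 * (+ 1 * (+ 3 * r + u * + 8) + (+ 8 * pf + + 0)) + (t * (+ 1 * qr + (+ 8 * qf + + 0)) + (+ 64 * t * (+ 1 * er + (+ 8 * ef + + 0)) + + 0)) - + 3 * r
    ≡ (u + pf + + 2 * s * qr + t * qf + + 8 * t * er + + 64 * t * ef) * + 8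
  collect = solve-∀

final-identity : ∀ {t d T T₀ T₁ a D p q r E F c} →
  + 24 * T ≡ + 24 * t * D - d * a → + 3 * a ≡ p + t * q + E * (+ 64 * t) → D ≡ r + F * + 8 →
  + 24 * T₀ ≡ - (+ 3 * d * p) → + 216 * r - + 3 * d * q - + 24 * T₁ ≡ c * + 192 →
  + 9 * T - (T₀ + t * T₁) ≡ (c + + 9 * F - d * E) * (+ 8 * t)
final-identity {t} {d} {T} {T₀} {T₁} {a} {D} {p} {q} {r} {E} {F} {c} hT ha refl hT₀ hT₁ =
  ℤₚ.*-cancelˡ-≡ (+ 24) _ _ (begin
    + 24 * (+ 9 * T - (T₀ + t * T₁))
      ≡⟨ step₁ T T₀ T₁ t ⟩
    + 9 * (+ 24 * T) - + 24 * T₀ - t * (+ 24 * T₁)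
      ≡⟨ cong₂ (λ x y → + 9 * x - y - t * (+ 24 * T₁)) hT hT₀ ⟩
    + 9 * (+ 24 * t * (r + F * + 8) - d * a) - - (+ 3 * d * p) - t * (+ 24 * T₁)
      ≡⟨ step₂ t (r + F * + 8) d a p T₁ ⟩
    + 216 * t * (r + F * + 8) - + 3 * d * (+ 3 * a) + + 3 * d * p - t * (+ 24 * T₁)
      ≡⟨ cong (λ x → + 216 * t * (r + F * + 8) - + 3 * d * x + + 3 * d * p - t * (+ 24 * T₁)) ha ⟩
    + 216 * t * (r + F * + 8) - + 3 * d * (p + t * q + E * (+ 64 * t)) + + 3 * d * p - t * (+ 24 * T₁)
      ≡⟨ step₃ t r F d p q E T₁ ⟩
    t * (+ 216 * r - + 3 * d * q - + 24 * T₁) + (+ 9 * F - d * E) * (+ 192 * t)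
      ≡⟨ cong (λ x → t * x + (+ 9 * F - d * E) * (+ 192 * t)) hT₁ ⟩
    t * (c * + 192) + (+ 9 * F - d * E) * (+ 192 * t)
      ≡⟨ step₄ t c F d E ⟩
    + 24 * ((c + + 9 * F - d * E) * (+ 8 * t)) ∎)
  where
  step₁ : ∀ T T₀ T₁ t → + 24 * (+ 9 * T - (T₀ + t * T₁)) ≡ + 9 * (+ 24 * T) - + 24 * T₀ - t * (+ 24 * T₁)
  step₁ = solve-∀
  step₂ : ∀ t D d a p T₁ → + 9 * (+ 24 * t * D - d * a) - - (+ 3 * d * p) - t * (+ 24 * T₁) ≡
                            + 216 * t * D - + 3 * d * (+ 3 * a) + + 3 * d * p - t * (+ 24 * T₁)
  step₂ = solve-∀
  step₃ : ∀ t r F d p q E T₁ →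
    + 216 * t * (r + F * + 8) - + 3 * d * (p + t * q + E * (+ 64 * t)) + + 3 * d * p - t * (+ 24 * T₁) ≡
    t * (+ 216 * r - + 3 * d * q - + 24 * T₁) + (+ 9 * F - d * E) * (+ 192 * t)
  step₃ = solve-∀
  step₄ : ∀ t c F d E → t * (c * + 192) + (+ 9 * F - d * E) * (+ 192 * t) ≡ + 24 * ((c + + 9 * F - d * E) * (+ 8 * t))
  step₄ = solve-∀

open CyclicConvolution 23
open BinomialSections 23

P Q₄ Q₈ Q R : Vector ℤ 24
P = lookup (+ 2 ∷ + 0 ∷ + 0 ∷ + 0 ∷ + 0 ∷ + 0 ∷ + 0 ∷ + 0 ∷ - + 1 ∷ + 0 ∷ + 0 ∷ + 0 ∷ + 0 ∷ + 0 ∷ + 0 ∷ + 0 ∷ - + 1 ∷ + 0 ∷ + 0 ∷ + 0 ∷ + 0 ∷ + 0 ∷ + 0 ∷ + 0 ∷ [])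
Q₄ = lookup (+ 60 ∷ + 24 ∷ + 52 ∷ + 8 ∷ + 34 ∷ + 56 ∷ + 28 ∷ + 40 ∷ + 2 ∷ + 0 ∷ + 48 ∷ + 0 ∷ + 60 ∷ + 0 ∷ + 48 ∷ + 0 ∷ + 2 ∷ + 40 ∷ + 28 ∷ + 56 ∷ + 34 ∷ + 8 ∷ + 52 ∷ + 24 ∷ [])
Q₈ = lookup (+ 28 ∷ + 24 ∷ + 20 ∷ + 8 ∷ + 50 ∷ + 56 ∷ + 28 ∷ + 40 ∷ + 50 ∷ + 0 ∷ + 16 ∷ + 0 ∷ + 28 ∷ + 0 ∷ + 16 ∷ + 0 ∷ + 50 ∷ + 40 ∷ + 28 ∷ + 56 ∷ + 50 ∷ + 8 ∷ + 20 ∷ + 24 ∷ [])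
Q = lookup (+ 28 ∷ + 24 ∷ + 20 ∷ + 8 ∷ + 18 ∷ + 56 ∷ + 28 ∷ + 40 ∷ + 18 ∷ + 0 ∷ + 16 ∷ + 0 ∷ + 28 ∷ + 0 ∷ + 16 ∷ + 0 ∷ + 18 ∷ + 40 ∷ + 28 ∷ + 56 ∷ + 18 ∷ + 8 ∷ + 20 ∷ + 24 ∷ [])
R = lookup (+ 3 ∷ + 5 ∷ + 3 ∷ + 5 ∷ + 3 ∷ + 5 ∷ + 3 ∷ + 5 ∷ + 0 ∷ + 0 ∷ + 0 ∷ + 0 ∷ + 0 ∷ + 0 ∷ + 0 ∷ + 0 ∷ + 5 ∷ + 3 ∷ + 5 ∷ + 3 ∷ + 5 ∷ + 3 ∷ + 5 ∷ + 3 ∷ [])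

opaque
  unfolding _⊛_

  P⊛P≡3P : ∀ d → (P ⊛ P) d ≡ + 3 * P d
  P⊛P≡3P = from-yes (all? λ d → (P ⊛ P) d ℤ.≟ + 3 * P d)

  64∣P⊛Q-3Q : ∀ d → + 64 ∣ˢ (P ⊛ Q) d - + 3 * Q d
  64∣P⊛Q-3Q = from-yes (all? λ d → + 64 ∣? ((P ⊛ Q) d - + 3 * Q d))

  8∣Q⊛Q : ∀ d → + 8 ∣ˢ (Q ⊛ Q) d
  8∣Q⊛Q = from-yes (all? λ d → + 8 ∣? (Q ⊛ Q) d)

  8∣P⊛R-3R : ∀ d → + 8 ∣ˢ (P ⊛ R) d - + 3 * R d
  8∣P⊛R-3R = from-yes (all? λ d → + 8 ∣? ((P ⊛ R) d - + 3 * R d))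

module Doubling (i : ℕ) (a : Vector ℤ 24)
  (3a≡P+tQ : ∀ x → + (2 ^ (10 ℕ.+ i)) ∣ˢ + 3 * a x - (P x + + (2 ^ (4 ℕ.+ i)) * Q x)) where

  private
    t = + (2 ^ (4 ℕ.+ i))
    E : Vector ℤ 24
    E x = quotient (3a≡P+tQ x)
    c : Vector ℤ 3
    c = + 1 ∷ᶠ t ∷ᶠ + 64 * t ∷ᶠ []ᶠ
    f : Vector (Vector ℤ 24) 3
    f = P ∷ᶠ Q ∷ᶠ E ∷ᶠ []ᶠ

    3a≗lincomb : ∀ x → + 3 * a x ≡ lincomb c f x
    3a≗lincomb x = begin
      + 3 * a x                                      ≡⟨ ≡+quotient (3a≡P+tQ x) ⟩
      P x + t * Q x + E x * + (2 ^ (10 ℕ.+ i))       ≡⟨ cong (λ m → P x + t * Q x + E x * m) (pow-split 6 (4 ℕ.+ i)) ⟩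
      P x + t * Q x + E x * (+ 64 * t)               ≡⟨ normalise (P x) (Q x) (E x) t ⟩
      lincomb c f x                                  ∎
      where
      normalise : ∀ p q e t → p + t * q + e * (+ 64 * t) ≡ + 1 * p + (t * q + (+ 64 * t * e + + 0))
      normalise = solve-∀

  square : ∀ d → + (2 ^ (11 ℕ.+ i)) ∣ˢ + 3 * (a ⊛ a) d - (P d + + (2 ^ (5 ℕ.+ i)) * Q d)
  square d = 2^j∣3x⇒2^j∣x (11 ℕ.+ i) (divides Z (begin
    + 3 * (+ 3 * (a ⊛ a) d - (P d + + (2 ^ (5 ℕ.+ i)) * Q d))
      ≡⟨ cong (λ x → + 3 * (+ 3 * (a ⊛ a) d - (P d + x * Q d))) (pow-split 1 (4 ℕ.+ i)) ⟩
    + 3 * (+ 3 * (a ⊛ a) d - (P d + + 2 * t * Q d))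
      ≡⟨ square-identity {+ (2 ^ i)} {t} {P d} {Q d} {V d} {W d} {(P ⊛ E) d} {(Q ⊛ E) d} {(E ⊛ E) d} (pow-split 4 i) expansion ⟩
    Z * (+ 128 * t)        ≡⟨ cong (Z *_) (pow-split 7 (4 ℕ.+ i)) ⟨
    Z * + (2 ^ (11 ℕ.+ i)) ∎))
    where
    V W : Vector ℤ 24
    V x = quotient (64∣P⊛Q-3Q x)
    W x = quotient (8∣Q⊛Q x)
    Z = V d + + (2 ^ i) * W d + (P ⊛ E) d + t * (Q ⊛ E) d + + 32 * t * (E ⊛ E) d
    M : Fin 3 → Fin 3 → ℤ
    M zero             zero             = + 3 * P d
    M zero             (suc zero)       = + 3 * Q d + V d * + 64
    M (suc zero)       zero             = + 3 * Q d + V d * + 64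
    M (suc zero)       (suc zero)       = W d * + 8
    M (suc (suc zero)) zero             = (P ⊛ E) d
    M zero             (suc (suc zero)) = (P ⊛ E) d
    M (suc (suc zero)) (suc zero)       = (Q ⊛ E) d
    M (suc zero)       (suc (suc zero)) = (Q ⊛ E) d
    M (suc (suc zero)) (suc (suc zero)) = (E ⊛ E) d
    table : ∀ k l → (f k ⊛ f l) d ≡ M k l
    table zero             zero             = P⊛P≡3P d
    table zero             (suc zero)       = ≡+quotient (64∣P⊛Q-3Q d)
    table (suc zero)       zero             = trans (⊛-comm Q P d) (≡+quotient (64∣P⊛Q-3Q d))
    table (suc zero)       (suc zero)       = Signed._∣_.equality (8∣Q⊛Q d)
    table (suc (suc zero)) zero             = ⊛-comm E P d
    table zero             (suc (suc zero)) = refl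
    table (suc (suc zero)) (suc zero)       = ⊛-comm E Q d
    table (suc zero)       (suc (suc zero)) = refl
    table (suc (suc zero)) (suc (suc zero)) = refl
    expansion : + 3 * (+ 3 * (a ⊛ a) d) ≡ ∑[ k < 3 ] (c k * ∑[ l < 3 ] (c l * M k l))
    expansion = begin
      + 3 * (+ 3 * (a ⊛ a) d)                              ≡⟨ cong (_*_ (+ 3)) (⊛-scaleˡ (+ 3) a a d) ⟨
      + 3 * ((λ x → + 3 * a x) ⊛ a) d                      ≡⟨ cong (_*_ (+ 3)) (⊛-comm (λ x → + 3 * a x) a d) ⟩
      + 3 * (a ⊛ (λ x → + 3 * a x)) d                      ≡⟨ ⊛-scaleˡ (+ 3) a (λ x → + 3 * a x) d ⟨
      ((λ x → + 3 * a x) ⊛ (λ x → + 3 * a x)) d            ≡⟨ ⊛-cong 3a≗lincomb 3a≗lincomb d ⟩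
      (lincomb c f ⊛ lincomb c f) d                        ≡⟨ ⊛-bilinear c f c f d ⟩
      ∑[ k < 3 ] (c k * ∑[ l < 3 ] (c l * (f k ⊛ f l) d))   ≡⟨ sum-cong-≗ (λ k → cong (c k *_) (sum-cong-≗ λ l → cong (c l *_) (table k l))) ⟩
      ∑[ k < 3 ] (c k * ∑[ l < 3 ] (c l * M k l))          ∎

  product : ∀ b → (∀ x → + 8 ∣ˢ b x - R x) → ∀ d → + 8 ∣ˢ (a ⊛ b) d - R d
  product b b≡R d = 2^j∣3x⇒2^j∣x 3 (divides Z
    (product-identity {+ (2 ^ i)} {t} {R d} {U d} {(P ⊛ R) d} {(P ⊛ F) d} {(Q ⊛ R) d} {(Q ⊛ F) d} {(E ⊛ R) d} {(E ⊛ F) d}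
       (pow-split 4 i) (≡+quotient (8∣P⊛R-3R d)) expansion))
    where
    F U : Vector ℤ 24
    F x = quotient (b≡R x)
    U x = quotient (8∣P⊛R-3R x)
    Z = U d + (P ⊛ F) d + + 2 * + (2 ^ i) * (Q ⊛ R) d + t * (Q ⊛ F) d + + 8 * t * (E ⊛ R) d + + 64 * t * (E ⊛ F) d
    c′ : Vector ℤ 2
    c′ = + 1 ∷ᶠ + 8 ∷ᶠ []ᶠ
    g : Vector (Vector ℤ 24) 2
    g = R ∷ᶠ F ∷ᶠ []ᶠ
    b≗lincomb : ∀ x → b x ≡ lincomb c′ g x
    b≗lincomb x = trans (≡+quotient (b≡R x)) (normalise (R x) (F x))
      where
      normalise : ∀ r f → r + f * + 8 ≡ + 1 * r + (+ 8 * f + + 0)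
      normalise = solve-∀
    expansion : + 3 * (a ⊛ b) d ≡ ∑[ k < 3 ] (c k * ∑[ l < 2 ] (c′ l * (f k ⊛ g l) d))
    expansion = begin
      + 3 * (a ⊛ b) d                  ≡⟨ ⊛-scaleˡ (+ 3) a b d ⟨
      ((λ x → + 3 * a x) ⊛ b) d        ≡⟨ ⊛-cong 3a≗lincomb b≗lincomb d ⟩
      (lincomb c f ⊛ lincomb c′ g) d   ≡⟨ ⊛-bilinear c f c′ g d ⟩
      ∑[ k < 3 ] (c k * ∑[ l < 2 ] (c′ l * (f k ⊛ g l) d)) ∎

Invariant : Vector ℤ 24 → ℕ → Set
Invariant Q′ j =
  (∀ d → + (2 ^ (6 ℕ.+ j)) ∣ˢ + 3 * ([1+x]^ (24 ℕ.* 2 ^ j)) d - (P d + + (2 ^ j) * Q′ d)) ×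
  (∀ d → + 8 ∣ˢ ([1+x]^ (24 ℕ.* 2 ^ j ℕ.∸ 1)) d - R d)

invariant? : ∀ Q′ j → Dec (Invariant Q′ j)
invariant? Q′ j = all? (λ d → _ ∣? _) ×-dec all? (λ d → _ ∣? _)

invariant-double : ∀ i → Invariant Q (4 ℕ.+ i) → Invariant Q (5 ℕ.+ i)
invariant-double i (3a≡P+tQ , b≡R) =
  (λ d → subst (λ x → + (2 ^ (11 ℕ.+ i)) ∣ˢ + 3 * x - (P d + + (2 ^ (5 ℕ.+ i)) * Q d)) (sym (row-square d)) (square d)) ,
  (λ d → subst (λ x → + 8 ∣ˢ x - R d) (sym (row-product d)) (product b b≡R d))
  where
  N = 24 ℕ.* 2 ^ (4 ℕ.+ i)
  a = [1+x]^ N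
  b = [1+x]^ (N ℕ.∸ 1)
  open Doubling i a 3a≡P+tQ
  double : ∀ x → 24 ℕ.* (2 ℕ.* x) ≡ 24 ℕ.* x ℕ.+ 24 ℕ.* x
  double = ℕ-Solver.solve-∀
  row-square : ∀ d → ([1+x]^ (24 ℕ.* 2 ^ (5 ℕ.+ i))) d ≡ (a ⊛ a) d
  row-square d = trans (cong (λ m → ([1+x]^ m) d) (double (2 ^ (4 ℕ.+ i)))) ([1+x]^-+ N N d)
  row-product : ∀ d → ([1+x]^ (24 ℕ.* 2 ^ (5 ℕ.+ i) ℕ.∸ 1)) d ≡ (a ⊛ b) d
  row-product d = trans (cong (λ m → ([1+x]^ (m ℕ.∸ 1)) d) (double (2 ^ (4 ℕ.+ i))))
                        (trans (cong (λ m → ([1+x]^ m) d) (ℕₚ.+-∸-assoc N (1≤24*2^j (4 ℕ.+ i)))) ([1+x]^-+ N (N ℕ.∸ 1) d))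

invariant-Q : ∀ i → Invariant Q (4 ℕ.+ i)
invariant-Q zero    = from-yes (invariant? Q 4)
invariant-Q (suc i) = invariant-double i (invariant-Q i)

T₀ T₁ : Fin 24 → Fin 24 → ℤ
T₀ = Toepl (+ 0 ∷ + 0 ∷ + 0 ∷ + 0 ∷ + 0 ∷ + 0 ∷ + 0 ∷ + 0 ∷ + 1 ∷ + 0 ∷ + 0 ∷ + 0 ∷ + 0 ∷ + 0 ∷ + 0 ∷ + 0 ∷ + 2 ∷ + 0 ∷ + 0 ∷ + 0 ∷ + 0 ∷ + 0 ∷ + 0 ∷ + 0 ∷ [])
           (+ 0 ∷ + 0 ∷ + 0 ∷ + 0 ∷ + 0 ∷ + 0 ∷ + 0 ∷ - + 1 ∷ + 0 ∷ + 0 ∷ + 0 ∷ + 0 ∷ + 0 ∷ + 0 ∷ + 0 ∷ - + 2 ∷ + 0 ∷ + 0 ∷ + 0 ∷ + 0 ∷ + 0 ∷ + 0 ∷ + 0 ∷ [])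
T₁ = Toepl (+ 3 ∷ + 0 ∷ + 0 ∷ + 0 ∷ + 4 ∷ + 0 ∷ + 0 ∷ + 0 ∷ + 3 ∷ + 0 ∷ + 4 ∷ + 0 ∷ + 6 ∷ + 0 ∷ + 4 ∷ + 0 ∷ + 4 ∷ + 0 ∷ + 4 ∷ + 0 ∷ + 6 ∷ + 0 ∷ + 4 ∷ + 0 ∷ [])
           (+ 0 ∷ + 0 ∷ + 0 ∷ + 4 ∷ + 0 ∷ + 0 ∷ + 0 ∷ + 2 ∷ + 0 ∷ + 4 ∷ + 0 ∷ + 2 ∷ + 0 ∷ + 4 ∷ + 0 ∷ + 1 ∷ + 0 ∷ + 4 ∷ + 0 ∷ + 2 ∷ + 0 ∷ + 4 ∷ + 0 ∷ [])

-- −3dP(e) − 24T₀ and 216R(e − 1) − 3dQ′(e) − 24T₁ are the parts of 24·(9T − T₀ − tT₁) that are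
-- not visibly divisible by 192t once the invariant is substituted into T-formula.
FinalCheck : Vector ℤ 24 → Set
FinalCheck Q′ = ∀ r s → let d = + toℕ r - + toℕ s; e = r ⊖ s in
  (+ 24 * T₀ r s ≡ - (+ 3 * d * P e)) × (+ 192 ∣ˢ + 216 * R (cpred e) - + 3 * d * Q′ e - + 24 * T₁ r s)

finalCheck? : ∀ Q′ → Dec (FinalCheck Q′)
finalCheck? Q′ = all? λ r → all? λ s → (_ ℤ.≟ _) ×-dec (_ ∣? _)

congruence : ∀ {Q′} j → Invariant Q′ j → FinalCheck Q′ → ∀ r s →
  + (2 ^ (3 ℕ.+ j)) ∣ˢ + 9 * T 24 (3 ℕ.* 2 ^ (3 ℕ.+ j)) r s - (T₀ r s + + (2 ^ j) * T₁ r s)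
congruence {Q′} j (row , previous) check r s = divides K (begin
  + 9 * T 24 (3 ℕ.* 2 ^ (3 ℕ.+ j)) r s - (T₀ r s + t * T₁ r s)
    ≡⟨ final-identity {t} {d} {T 24 (3 ℕ.* 2 ^ (3 ℕ.+ j)) r s} {T₀ r s} {T₁ r s} {a} {D} {P e} {Q′ e} {R (cpred e)} {E} {F} {c}
         T-formula′ 3a≡ (≡+quotient (previous (cpred e))) (proj₁ (check r s)) (Signed._∣_.equality (proj₂ (check r s))) ⟩
  K * (+ 8 * t)          ≡⟨ cong (K *_) (pow-split 3 j) ⟨
  K * + (2 ^ (3 ℕ.+ j))  ∎)
  where
  t = + (2 ^ j)
  d = + toℕ r - + toℕ s
  e = r ⊖ s
  N = 24 ℕ.* 2 ^ j
  a = ([1+x]^ N) e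
  D = ([1+x]^ (N ℕ.∸ 1)) (cpred e)
  E = quotient (row e)
  F = quotient (previous (cpred e))
  c = quotient (proj₂ (check r s))
  K = c + + 9 * F - d * E
  times-8 : ∀ x → 3 ℕ.* (2 ℕ.* (2 ℕ.* (2 ℕ.* x))) ≡ 24 ℕ.* x
  times-8 = ℕ-Solver.solve-∀
  index : 3 ℕ.* 2 ^ (3 ℕ.+ j) ≡ suc (N ℕ.∸ 1)
  index = trans (times-8 (2 ^ j)) (sym (ℕₚ.m+[n∸m]≡n (1≤24*2^j j)))
  T-formula′ : + 24 * T 24 (3 ℕ.* 2 ^ (3 ℕ.+ j)) r s ≡ + 24 * t * D - d * a
  T-formula′ = begin
    + 24 * T 24 (3 ℕ.* 2 ^ (3 ℕ.+ j)) r s                 ≡⟨ cong (λ n → + 24 * T 24 n r s) index ⟩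
    + 24 * T 24 (suc (N ℕ.∸ 1)) r s                        ≡⟨ T-formula (N ℕ.∸ 1) r s ⟩
    + suc (N ℕ.∸ 1) * D - d * ([1+x]^ suc (N ℕ.∸ 1)) e
      ≡⟨ cong₂ (λ n n′ → n * D - d * ([1+x]^ n′) e) (trans (cong +_ index′) (ℤₚ.pos-* 24 (2 ^ j))) index′ ⟩
    + 24 * t * D - d * a                                   ∎
    where
    index′ = ℕₚ.m+[n∸m]≡n (1≤24*2^j j)
  3a≡ : + 3 * a ≡ P e + t * Q′ e + E * (+ 64 * t)
  3a≡ = trans (≡+quotient (row e)) (cong (λ m → P e + t * Q′ e + E * m) (pow-split 6 j))

certificate : ∀ i → Σ[ Q′ ∈ Vector ℤ 24 ] Invariant Q′ (2 ℕ.+ i) × FinalCheck Q′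
certificate 0             = Q₄ , from-yes (invariant? Q₄ 2) , from-yes (finalCheck? Q₄)
certificate 1             = Q₈ , from-yes (invariant? Q₈ 3) , from-yes (finalCheck? Q₈)
certificate (suc (suc i)) = Q  , invariant-Q i              , from-yes (finalCheck? Q)

theorem9 : (u : ℕ) → 5 ≤ u → (r s : Fin 24) →
    (+ (2 ^ u)) ∣ ((+ 9 * T 24 (3 *ℕ 2 ^ u) r s) -
      (Toepl (+ 0 ∷ + 0 ∷ + 0 ∷ + 0 ∷ + 0 ∷ + 0 ∷ + 0 ∷ + 0 ∷ + 1 ∷ + 0 ∷ + 0 ∷ + 0 ∷ + 0 ∷ + 0 ∷ + 0 ∷ + 0 ∷ + 2 ∷ + 0 ∷ + 0 ∷ + 0 ∷ + 0 ∷ + 0 ∷ + 0 ∷ + 0 ∷ [])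
             (+ 0 ∷ + 0 ∷ + 0 ∷ + 0 ∷ + 0 ∷ + 0 ∷ + 0 ∷ - + 1 ∷ + 0 ∷ + 0 ∷ + 0 ∷ + 0 ∷ + 0 ∷ + 0 ∷ + 0 ∷ - + 2 ∷ + 0 ∷ + 0 ∷ + 0 ∷ + 0 ∷ + 0 ∷ + 0 ∷ + 0 ∷ []) r s
       + + (2 ^ (u ∸ 3)) *
         Toepl (+ 3 ∷ + 0 ∷ + 0 ∷ + 0 ∷ + 4 ∷ + 0 ∷ + 0 ∷ + 0 ∷ + 3 ∷ + 0 ∷ + 4 ∷ + 0 ∷ + 6 ∷ + 0 ∷ + 4 ∷ + 0 ∷ + 4 ∷ + 0 ∷ + 4 ∷ + 0 ∷ + 6 ∷ + 0 ∷ + 4 ∷ + 0 ∷ [])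
               (+ 0 ∷ + 0 ∷ + 0 ∷ + 4 ∷ + 0 ∷ + 0 ∷ + 0 ∷ + 2 ∷ + 0 ∷ + 4 ∷ + 0 ∷ + 2 ∷ + 0 ∷ + 4 ∷ + 0 ∷ + 1 ∷ + 0 ∷ + 4 ∷ + 0 ∷ + 2 ∷ + 0 ∷ + 4 ∷ + 0 ∷ []) r s))
theorem9 _ (s≤s (s≤s (s≤s (s≤s (s≤s {n = i} z≤n))))) r s =
  let Q′ , invariant , check = certificate i in ∣⇒∣ᵤ (congruence (2 ℕ.+ i) invariant check r s)
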